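{- Let $\tilde{\mathbf{K}}$ be the axiomatic system described in the context. Then $\Diamond p\leftrightarrow\neg\Box\neg p$ is not a theorem of $\tilde{\mathbf{K}}$, where $p$ is a propositional variable; that is, $\nvdash_{\tilde{\mathbf{K}}}\Diamond p\leftrightarrow\neg\Box\neg p$.
   Context: Fix a set $PV$ of propositional variables. Formulas are built by $\varphi::=p\mid\neg\varphi\mid(\varphi\to\varphi)\mid\Box\varphi\mid\Diamond\varphi$ with $p\in PV$; $\land,\lor,\leftrightarrow$ are defined from $\neg,\to$ as usual. The system $\tilde{\mathbf{K}}$ has as axioms: all instances (in this language) of classical propositional tautologies (PC); all instances of the schema $\mathrm{K}$: $\Box(\varphi\to\psi)\to(\Box\varphi\to\Box\psi)$; all instances of the schema $\mathrm{Dual}$: $\Box\varphi\leftrightarrow\neg\Diamond\neg\varphi$. Its rules are modus ponens (from $\varphi$ and $\varphi\to\psi$ infer $\psi$) and necessitation RN (from $\varphi$ infer $\Box\varphi$). A theorem is a formula having a finite derivation from the axioms using these rules. -}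

module Defs where

open import Data.Bool using (Bool; true; false; not; _∧_; _∨_)
open import Relation.Binary.PropositionalEquality using (_≡_)

data Formula (PV : Set) : Set where
  var  : PV → Formula PV
  ¬'_  : Formula PV → Formula PV
  _⇒_  : Formula PV → Formula PV → Formula PV
  □_   : Formula PV → Formula PV
  ◇_   : Formula PV → Formula PV

infixr 20 _⇒_
infix 30 ¬'_ □_ ◇_

module _ {PV : Set} where

  _∧'_ : Formula PV → Formula PV → Formula PV
  φ ∧' ψ = ¬' (φ ⇒ ¬' ψ)

  _∨'_ : Formula PV → Formula PV → Formula PV
  φ ∨' ψ = ¬' φ ⇒ ψ

  _⇔_ : Formula PV → Formula PV → Formula PV
  φ ⇔ ψ = (φ ⇒ ψ) ∧' (ψ ⇒ φ)

  -- Classical truth value, treating variables and modal formulas □φ, ◇φ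
  -- as propositional atoms whose values are given by the valuation v.
  ⟦_⟧ : Formula PV → (Formula PV → Bool) → Bool
  ⟦ var p ⟧ v = v (var p)
  ⟦ ¬' φ ⟧ v = not (⟦ φ ⟧ v)
  ⟦ φ ⇒ ψ ⟧ v = not (⟦ φ ⟧ v) ∨ ⟦ ψ ⟧ v
  ⟦ □ φ ⟧ v = v (□ φ)
  ⟦ ◇ φ ⟧ v = v (◇ φ)

  Tautology : Formula PV → Set
  Tautology φ = (v : Formula PV → Bool) → ⟦ φ ⟧ v ≡ true

  data ⊢K̃_ : Formula PV → Set where
    ax-PC   : ∀ {φ} → Tautology φ → ⊢K̃ φ
    ax-K    : ∀ {φ ψ} → ⊢K̃ (□ (φ ⇒ ψ) ⇒ (□ φ ⇒ □ ψ))
    ax-Dual : ∀ {φ} → ⊢K̃ (□ φ ⇔ ¬' ◇ ¬' φ)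
    mp      : ∀ {φ ψ} → ⊢K̃ φ → ⊢K̃ (φ ⇒ ψ) → ⊢K̃ ψ
    nec     : ∀ {φ} → ⊢K̃ φ → ⊢K̃ (□ φ)

  infix 10 ⊢K̃_

-- K̃ only links □ to ◇ through ◇¬: Dual says nothing about ◇ applied to a
-- formula that is not a negation. So the valuation making every □φ true,
-- every ◇¬φ false and every other ◇φ true validates all axioms and is
-- preserved by the rules, yet it makes ◇p true and ¬□¬p false.
module Submission where

open import Defs
open import Data.Bool using (Bool; true; false)
open import Relation.Nullary using (¬_)
open import Relation.Binary.PropositionalEquality using (_≡_; refl)

module _ {PV : Set} where

  sound-if-□-true-◇¬-false :
    (v : Formula PV → Bool) →
    (∀ φ → v (□ φ) ≡ true) → (∀ φ → v (◇ ¬' φ) ≡ false) →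
    ∀ {φ} → ⊢K̃ φ → ⟦ φ ⟧ v ≡ true
  sound-if-□-true-◇¬-false v □-true ◇¬-false = sound
    where
    sound : ∀ {φ} → ⊢K̃ φ → ⟦ φ ⟧ v ≡ true
    sound (ax-PC taut)     = taut v
    sound (ax-K {φ} {ψ})   rewrite □-true (φ ⇒ ψ) | □-true φ | □-true ψ = refl
    sound (ax-Dual {φ})    rewrite □-true φ | ◇¬-false φ = refl
    sound (mp {φ} ⊢φ ⊢φ⇒ψ) with ⟦ φ ⟧ v | sound ⊢φ | sound ⊢φ⇒ψ
    ... | .true | refl | ψ-true = ψ-true
    sound (nec {φ} _)      = □-true φ

  false-only-on-◇¬ : Formula PV → Bool
  false-only-on-◇¬ (◇ ¬' _) = false
  false-only-on-◇¬ _         = true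

proposition1 : {PV : Set} (p : PV) → ¬ (⊢K̃ (◇ var p ⇔ ¬' □ ¬' var p))
proposition1 p ⊢dual-converse
  with sound-if-□-true-◇¬-false false-only-on-◇¬ (λ _ → refl) (λ _ → refl) ⊢dual-converse
... | ()
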